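{- Let $A$ be a finite abelian group of order $n$. The number of quadruples $(C,Z,S',S'')$ such that $C,Z$ are subgroups of $A$ with $A=C\times Z$, $C$ is cyclic of order $t\geq 4$, $Z$ is an elementary abelian $2$-group, $S'\in\{C,\emptyset,\{1\},C\setminus\{1\}\}$ and $S''\subseteq Z$, is at most $2^{n/4+2\log_2 n-1}$. -}

module Defs where

open import Data.Nat using (ℕ; zero; suc; _≤_)
open import Data.Fin using (Fin)
open import Data.Fin.Subset using (Subset; _∈_; _⊆_; ⊥; ⁅_⁆; ∁; _∩_; ∣_∣)
open import Data.Product using (Σ; ∃; _×_)
open import Data.Sum using (_⊎_)
open import Relation.Binary.PropositionalEquality using (_≡_)

-- A finite abelian group of order n is (up to isomorphism) an abelian group
-- structure on the carrier Fin n with propositional equality; the operations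
-- _∙_, ε, _⁻¹ are passed explicitly, together with an IsAbelianGroup proof
-- in the statement.
module GroupDefs {n : ℕ} (_∙_ : Fin n → Fin n → Fin n) (ε : Fin n) (_⁻¹ : Fin n → Fin n) where

  pow : Fin n → ℕ → Fin n
  pow g zero = ε
  pow g (suc k) = g ∙ pow g k

  IsSubgroup : Subset n → Set
  IsSubgroup H = (ε ∈ H) × (∀ x y → x ∈ H → y ∈ H → (x ∙ y) ∈ H) × (∀ x → x ∈ H → (x ⁻¹) ∈ H)

  IsCyclicOfOrder : Subset n → ℕ → Set
  IsCyclicOfOrder H t = (∃ λ g → (g ∈ H) × (∀ x → x ∈ H → ∃ λ k → x ≡ pow g k)) × (∣ H ∣ ≡ t)

  IsElemAbelian2 : Subset n → Set
  IsElemAbelian2 H = ∀ x → x ∈ H → (x ∙ x) ≡ ε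

  IsInternalDirectProduct : Subset n → Subset n → Set
  IsInternalDirectProduct C Z =
    (∀ x → x ∈ C → x ∈ Z → x ≡ ε) ×
    (∀ a → ∃ λ c → ∃ λ z → (c ∈ C) × (z ∈ Z) × (a ≡ (c ∙ z)))

  Quad : Set
  Quad = Subset n × Subset n × Subset n × Subset n

  Valid : Quad → Set
  Valid (C Data.Product., Z Data.Product., S′ Data.Product., S″) =
    IsSubgroup C × IsSubgroup Z × IsInternalDirectProduct C Z ×
    (∃ λ t → (4 ≤ t) × IsCyclicOfOrder C t) ×
    IsElemAbelian2 Z ×
    ((S′ ≡ C) ⊎ (S′ ≡ ⊥) ⊎ (S′ ≡ ⁅ ε ⁆) ⊎ (S′ ≡ (C ∩ ∁ ⁅ ε ⁆))) ×
    (S″ ⊆ Z)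

-- A cyclic C of order at least 4 has two distinct generators g ≠ g⁻¹, each of which determines C,
-- so there are at most n/2 choices of C. Fix C and one elementary abelian complement Z₀. Relative to
-- any other such complement Z, the C-component of an element of Z₀ squares to 1, so it is 1 or the
-- unique involution of C, and it is the involution exactly on Z₀ ∖ Z. Hence Z₀ ∖ Z is the support of a
-- homomorphism Z₀ → ℤ/2, and it determines Z; an elementary abelian 2-group Z₀ has at most
-- |Z₀| ≤ n/4 such homomorphisms. With 4 choices of S′ and 2^|Z| ≤ 2^(n/4) of S″ there are at most
-- (n/2)(n/4)·4·2^(n/4) = 2^(n/4 + 2 log₂ n - 1) quadruples.

module Submission where

open import Defs
open import Level using (0ℓ)
open import Function using (_∘_)
open import Data.Empty using (⊥-elim)
open import Data.Product using (∃; _×_; _,_; proj₁; proj₂; uncurry)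
open import Data.Sum using (_⊎_; inj₁; inj₂; [_,_]′; fromInj₂)
open import Data.Bool using (true; false; not; _∧_; _xor_)
open import Data.Bool.Properties using (∧-identityʳ; xor-same)
import Data.Bool.Properties as Bool
open import Data.Nat using (ℕ; zero; suc; _+_; _∸_; _*_; _^_; _≤_; _<_; z≤n; s≤s; z<s; NonZero; >-nonZero)
open import Data.Nat.Properties
  using ( +-suc; +-identityʳ; *-comm; *-distribˡ-+; *-cancelˡ-≡; m+n≡0⇒m≡0; m+[n∸m]≡n; m∸n≤m; m<n⇒0<n∸m
        ; ≤-reflexive; ≤-trans; ≤-antisym; ≤-pred; n≤1+n; m≤m+n; <⇒≤; <⇒≱; <-irrefl; <-≤-trans
        ; +-mono-≤; +-monoʳ-≤; +-mono-<; *-mono-≤; *-monoˡ-≤; *-monoʳ-≤; ^-monoˡ-≤; ^-monoʳ-≤; ^-*-assoc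
        ; module ≤-Reasoning )
open import Data.Nat.DivMod using (_%_; _/_; m≡m%n+[m/n]*n; m%n<n; m*n/n≡m; /-monoˡ-≤; m/n*n≤m)
open import Data.Nat.Divisibility using (_∣_; divides; m%n≡0⇒n∣m)
open import Data.Nat.Solver using (module +-*-Solver)
open import Data.Fin using (Fin; zero; suc)
open import Data.Fin.Properties using (suc-injective; _≟_; any?)
open import Data.Fin.Subset using (Subset; _∈_; _∉_; _⊆_; _⊂_; _⊃_; ∣_∣; ⊤; ⊥; ⁅_⁆; ∁; _∩_; _∪_)
open import Data.Fin.Subset.Properties
  using ( _∈?_; drop-∷-⊆; ⊆-antisym; ∈⊤; ∣⊤∣≡n; x∈⁅x⁆; x∈⁅y⁆⇒x≡y; ∣⁅x⁆∣≡1; Empty-unique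
        ; p⊆p∪q; q⊆p∪q; x∈p∪q⁻; p∩q⊆p; p∩q⊆q; x∈p∩q⁺; x∈p∩q⁻; x∈∁p⇒x∉p; x∉p⇒x∈∁p )
open import Data.Fin.Subset.Induction using (⊃-wellFounded; Acc; acc)
open import Data.Vec using ([]; _∷_; here; there; lookup; tabulate)
open import Data.Vec.Properties
  using (≡-dec; lookup⇒[]=; []=⇒lookup; lookup-zipWith; lookup-map; lookup∘tabulate; tabulate∘lookup; tabulate-cong)
open import Data.List using (List; []; _∷_; [_]; length; map; filter; _++_; deduplicate; cartesianProduct; applyUpTo)
open import Data.List.Properties using (length-map; length-++; length-applyUpTo)
open import Data.List.Membership.Propositional using () renaming (_∈_ to _∈ₗ_)
open import Data.List.Membership.Propositional.Properties
  using ( ∈-map⁺; ∈-map⁻; ∈-++⁺ˡ; ∈-++⁺ʳ; ∈-++⁻; ∈-filter⁻; ∈-deduplicate⁺; ∈-deduplicate⁻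
        ; ∈-applyUpTo⁺; ∈-applyUpTo⁻; ∈-cartesianProduct⁺; ∈-cartesianProduct⁻ )
open import Data.List.Relation.Unary.Any using (here; there)
open import Data.List.Relation.Unary.All as All using (All; []; _∷_)
import Data.List.Relation.Unary.All.Properties as All
open import Data.List.Relation.Unary.AllPairs using ([]; _∷_)
open import Data.List.Relation.Unary.Unique.Propositional using (Unique)
import Data.List.Relation.Unary.Unique.Propositional.Properties as Unique
import Data.List.Relation.Unary.Unique.DecPropositional.Properties as UniqueDec
open import Relation.Nullary using (¬?; yes; no; contradiction)
open import Relation.Nullary.Decidable using (decidable-stable; _×-dec_)
open import Relation.Unary using (Decidable)
open import Relation.Binary using (DecidableEquality)
open import Relation.Binary.PropositionalEquality
  using (_≡_; _≢_; refl; sym; trans; cong; cong₂; subst; module ≡-Reasoning)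
open import Algebra.Bundles using (AbelianGroup)
open import Algebra.Structures using (IsAbelianGroup)
import Algebra.Properties.Group as GroupProperties
import Algebra.Properties.CommutativeSemigroup as CommutativeSemigroupProperties

-- Counting duplicate-free lists

module _ {A : Set} where

  private
    remove : {x : A} {ys : List A} → x ∈ₗ ys →
      ∃ λ zs → length ys ≡ suc (length zs) × (∀ {y} → y ∈ₗ ys → y ≢ x → y ∈ₗ zs)
    remove {ys = y ∷ ys} (here refl) =
      ys , refl , λ { (here refl) y≢x → ⊥-elim (y≢x refl) ; (there p) _ → p }
    remove {ys = y ∷ ys} (there p) with remove p
    ... | zs , eq , keep = y ∷ zs , cong suc eq ,
      λ { (here refl) _ → here refl ; (there q) y≢x → there (keep q y≢x) }

  Unique-⊆⇒length≤ : {xs ys : List A} → Unique xs → (∀ {x} → x ∈ₗ xs → x ∈ₗ ys) → length xs ≤ length ys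
  Unique-⊆⇒length≤ {[]} _ _ = z≤n
  Unique-⊆⇒length≤ {x ∷ xs} (x∉xs ∷ u) xs⊆ys with remove (xs⊆ys (here refl))
  ... | zs , eq , keep rewrite eq =
    s≤s (Unique-⊆⇒length≤ u (λ p → keep (xs⊆ys (there p)) (λ { refl → All.lookup x∉xs p refl })))

  Unique-map⁺ : ∀ {B : Set} {f : A → B} {xs : List A} → Unique xs →
    (∀ {x y} → x ∈ₗ xs → y ∈ₗ xs → f x ≡ f y → x ≡ y) → Unique (map f xs)
  Unique-map⁺ {xs = []} _ _ = []
  Unique-map⁺ {xs = x ∷ xs} (x∉xs ∷ u) inj =
    All.map⁺ (All.tabulate (λ p fx≡fy → All.lookup x∉xs p (inj (here refl) (there p) fx≡fy)))
    ∷ Unique-map⁺ u (λ p q → inj (there p) (there q))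

  length-filter-∁ : ∀ {P : A → Set} (P? : Decidable P) xs →
    length xs ≡ length (filter P? xs) + length (filter (¬? ∘ P?) xs)
  length-filter-∁ P? [] = refl
  length-filter-∁ P? (x ∷ xs) with P? x
  ... | yes _ = cong suc (length-filter-∁ P? xs)
  ... | no  _ = trans (cong suc (length-filter-∁ P? xs)) (sym (+-suc _ _))

  module _ {K : Set} (_≟_ : DecidableEquality K) (key : A → K) where

    keys : List A → List K
    keys xs = deduplicate _≟_ (map key xs)

    ∈-keys⁻ : ∀ xs {k} → k ∈ₗ keys xs → ∃ λ x → x ∈ₗ xs × k ≡ key x
    ∈-keys⁻ xs p = ∈-map⁻ key (∈-deduplicate⁻ _≟_ (map key xs) p)

    keys-Unique : ∀ xs → Unique (keys xs)
    keys-Unique xs = UniqueDec.deduplicate-! _≟_ (map key xs)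

    private
      length≤length*fibre : (P : A → Set) (b : ℕ) (ks : List K) →
        (∀ {k} → k ∈ₗ ks → ∀ ys → Unique ys → All (λ y → P y × key y ≡ k) ys → length ys ≤ b) →
        ∀ xs → Unique xs → All P xs → All (λ x → key x ∈ₗ ks) xs → length xs ≤ length ks * b
      length≤length*fibre P b [] _ [] _ _ _ = z≤n
      length≤length*fibre P b [] _ (x ∷ xs) _ _ (() ∷ _)
      length≤length*fibre P b (k ∷ ks) fibre xs u ps ks∋ = begin
        length xs                                                      ≡⟨ length-filter-∁ at-k? xs ⟩
        length (filter at-k? xs) + length (filter (¬? ∘ at-k?) xs)     ≤⟨ +-mono-≤ bound-at-k bound-rest ⟩
        b + length ks * b                                              ∎
        where
          open ≤-Reasoning
          at-k? = λ x → key x ≟ k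

          bound-at-k = fibre (here refl) (filter at-k? xs) (Unique.filter⁺ at-k? u)
            (All.zipWith (λ p → p) (All.filter⁺ at-k? ps , All.all-filter at-k? xs))

          bound-rest = length≤length*fibre P b ks (fibre ∘ there) (filter (¬? ∘ at-k?) xs)
            (Unique.filter⁺ (¬? ∘ at-k?) u) (All.filter⁺ (¬? ∘ at-k?) ps)
            (All.zipWith (λ { (here eq , ≢k) → ⊥-elim (≢k eq) ; (there p , _) → p })
              (All.filter⁺ (¬? ∘ at-k?) ks∋ , All.all-filter (¬? ∘ at-k?) xs))

    length≤∣keys∣*fibre : (P : A → Set) (b : ℕ) (xs : List A) → Unique xs → All P xs →
      (∀ {k} → k ∈ₗ keys xs → ∀ ys → Unique ys → All (λ y → P y × key y ≡ k) ys → length ys ≤ b) →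
      length xs ≤ length (keys xs) * b
    length≤∣keys∣*fibre P b xs u ps fibre =
      length≤length*fibre P b (keys xs) fibre xs u ps
        (All.tabulate (λ p → ∈-deduplicate⁺ _≟_ (∈-map⁺ key p)))

length-cartesianProduct : ∀ {A B : Set} (xs : List A) (ys : List B) →
  length (cartesianProduct xs ys) ≡ length xs * length ys
length-cartesianProduct [] ys = refl
length-cartesianProduct (x ∷ xs) ys =
  trans (length-++ (map (x ,_) ys)) (cong₂ _+_ (length-map _ ys) (length-cartesianProduct xs ys))

-- Subsets of Fin n

elements : ∀ {n} → Subset n → List (Fin n)
elements [] = []
elements (true ∷ p) = zero ∷ map suc (elements p)
elements (false ∷ p) = map suc (elements p)

length-elements : ∀ {n} (p : Subset n) → length (elements p) ≡ ∣ p ∣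
length-elements [] = refl
length-elements (true ∷ p) = cong suc (trans (length-map suc (elements p)) (length-elements p))
length-elements (false ∷ p) = trans (length-map suc (elements p)) (length-elements p)

∈-elements⁻ : ∀ {n} {p : Subset n} {x} → x ∈ₗ elements p → x ∈ p
∈-elements⁻ {p = true ∷ p} (here refl) = here
∈-elements⁻ {p = true ∷ p} (there q) with ∈-map⁻ suc q
... | y , y∈ , refl = there (∈-elements⁻ y∈)
∈-elements⁻ {p = false ∷ p} q with ∈-map⁻ suc q
... | y , y∈ , refl = there (∈-elements⁻ y∈)

∈-elements⁺ : ∀ {n} {p : Subset n} {x} → x ∈ p → x ∈ₗ elements p
∈-elements⁺ {p = true ∷ p} here = here refl
∈-elements⁺ {p = true ∷ p} (there q) = there (∈-map⁺ suc (∈-elements⁺ q))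
∈-elements⁺ {p = false ∷ p} (there q) = ∈-map⁺ suc (∈-elements⁺ q)

elements-Unique : ∀ {n} (p : Subset n) → Unique (elements p)
elements-Unique [] = []
elements-Unique (true ∷ p) =
  All.map⁺ (All.universal (λ _ ()) (elements p)) ∷ Unique.map⁺ suc-injective (elements-Unique p)
elements-Unique (false ∷ p) = Unique.map⁺ suc-injective (elements-Unique p)

Unique⇒length≤∣_∣ : ∀ {n} (p : Subset n) {xs} → Unique xs → (∀ {x} → x ∈ₗ xs → x ∈ p) → length xs ≤ ∣ p ∣
Unique⇒length≤∣ p ∣ u xs⊆p =
  subst (_ ≤_) (length-elements p) (Unique-⊆⇒length≤ u (∈-elements⁺ ∘ xs⊆p))

∣_∣≤length : ∀ {n} (p : Subset n) {ys} → (∀ {x} → x ∈ p → x ∈ₗ ys) → ∣ p ∣ ≤ length ys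
∣ p ∣≤length p⊆ys =
  subst (_≤ _) (length-elements p) (Unique-⊆⇒length≤ (elements-Unique p) (p⊆ys ∘ ∈-elements⁻))

Unique⇒length≤n : ∀ {n} {xs : List (Fin n)} → Unique xs → length xs ≤ n
Unique⇒length≤n {n} {xs} u = subst (length xs ≤_) (∣⊤∣≡n n) (Unique⇒length≤∣ ⊤ ∣ u (λ _ → ∈⊤))

subsetsOf : ∀ {n} → Subset n → List (Subset n)
subsetsOf [] = [] ∷ []
subsetsOf (false ∷ p) = map (false ∷_) (subsetsOf p)
subsetsOf (true ∷ p) = map (false ∷_) (subsetsOf p) ++ map (true ∷_) (subsetsOf p)

length-subsetsOf : ∀ {n} (p : Subset n) → length (subsetsOf p) ≡ 2 ^ ∣ p ∣
length-subsetsOf [] = refl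
length-subsetsOf (false ∷ p) = trans (length-map _ (subsetsOf p)) (length-subsetsOf p)
length-subsetsOf (true ∷ p) = begin
  length (map (false ∷_) (subsetsOf p) ++ map (true ∷_) (subsetsOf p))
    ≡⟨ length-++ (map (false ∷_) (subsetsOf p)) ⟩
  length (map (false ∷_) (subsetsOf p)) + length (map (true ∷_) (subsetsOf p))
    ≡⟨ cong₂ _+_ (length-map _ (subsetsOf p)) (length-map _ (subsetsOf p)) ⟩
  length (subsetsOf p) + length (subsetsOf p)
    ≡⟨ cong₂ _+_ (length-subsetsOf p) (trans (length-subsetsOf p) (sym (+-identityʳ _))) ⟩
  2 ^ ∣ p ∣ + (2 ^ ∣ p ∣ + 0) ∎
  where open ≡-Reasoning

∈-subsetsOf : ∀ {n} {p q : Subset n} → q ⊆ p → q ∈ₗ subsetsOf p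
∈-subsetsOf {p = []} {[]} _ = here refl
∈-subsetsOf {p = false ∷ p} {false ∷ q} q⊆p = ∈-map⁺ _ (∈-subsetsOf (drop-∷-⊆ q⊆p))
∈-subsetsOf {p = false ∷ p} {true ∷ q} q⊆p with q⊆p here
... | ()
∈-subsetsOf {p = true ∷ p} {false ∷ q} q⊆p = ∈-++⁺ˡ (∈-map⁺ _ (∈-subsetsOf (drop-∷-⊆ q⊆p)))
∈-subsetsOf {p = true ∷ p} {true ∷ q} q⊆p =
  ∈-++⁺ʳ (map (false ∷_) (subsetsOf p)) (∈-map⁺ _ (∈-subsetsOf (drop-∷-⊆ q⊆p)))

lookup≡true⇒∈ : ∀ {n} {p : Subset n} {x} → lookup p x ≡ true → x ∈ p
lookup≡true⇒∈ {p = p} {x} = lookup⇒[]= x p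

lookup≡false⇒∉ : ∀ {n} {p : Subset n} {x} → lookup p x ≡ false → x ∉ p
lookup≡false⇒∉ p[x]≡false x∈p with () ← trans (sym ([]=⇒lookup x∈p)) p[x]≡false

∉⇒lookup≡false : ∀ {n} {p : Subset n} {x} → x ∉ p → lookup p x ≡ false
∉⇒lookup≡false {p = p} {x} x∉p with lookup p x in p[x]≡b
... | true = ⊥-elim (x∉p (lookup≡true⇒∈ p[x]≡b))
... | false = refl

lookup-∩-∈ʳ : ∀ {n} (p : Subset n) {q x} → x ∈ q → lookup (p ∩ q) x ≡ lookup p x
lookup-∩-∈ʳ p {q} {x} x∈q =
  trans (lookup-zipWith _∧_ x p q) (trans (cong (lookup p x ∧_) ([]=⇒lookup x∈q)) (∧-identityʳ _))

lookup-∩∁-∈ : ∀ {n} {p q : Subset n} {x} → x ∈ p → lookup (p ∩ ∁ q) x ≡ not (lookup q x)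
lookup-∩∁-∈ {p = p} {q} {x} x∈p =
  trans (lookup-zipWith _∧_ x p (∁ q)) (cong₂ _∧_ ([]=⇒lookup x∈p) (lookup-map x not q))

Subset-ext : ∀ {n} {p q : Subset n} → (∀ x → lookup p x ≡ lookup q x) → p ≡ q
Subset-ext {p = p} {q} p≗q = trans (sym (tabulate∘lookup p)) (trans (tabulate-cong p≗q) (tabulate∘lookup q))

-- Read b, c, d as x ∈ Z, y ∈ Z, x ∙ y ∈ Z for a subgroup Z of index at most two.
not-xor-not : ∀ {b c d} → (b ≡ true → c ≡ true → d ≡ true) → (b ≡ true → d ≡ true → c ≡ true) →
  (c ≡ true → d ≡ true → b ≡ true) → (b ≡ false → c ≡ false → d ≡ true) → not d ≡ not b xor not c
not-xor-not {true}  {true}  {true}  _ _ _ _ = refl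
not-xor-not {true}  {true}  {false} bc⇒d _ _ _ with () ← bc⇒d refl refl
not-xor-not {true}  {false} {true}  _ bd⇒c _ _ with () ← bd⇒c refl refl
not-xor-not {true}  {false} {false} _ _ _ _ = refl
not-xor-not {false} {true}  {true}  _ _ cd⇒b _ with () ← cd⇒b refl refl
not-xor-not {false} {true}  {false} _ _ _ _ = refl
not-xor-not {false} {false} {true}  _ _ _ _ = refl
not-xor-not {false} {false} {false} _ _ _ b̄c̄⇒d with () ← b̄c̄⇒d refl refl

half-of-multiple : ∀ {a t} → a < t → t ∣ a + a → a ≡ 0 ⊎ a + a ≡ t
half-of-multiple {a} a<t (divides zero a+a≡0) = inj₁ (m+n≡0⇒m≡0 a a+a≡0)
half-of-multiple {t = t} a<t (divides (suc zero) a+a≡t) = inj₂ (trans a+a≡t (+-identityʳ t))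
half-of-multiple {t = t} a<t (divides (suc (suc q)) a+a≡qt) =
  ⊥-elim (<-irrefl a+a≡qt (<-≤-trans (+-mono-< a<t a<t) (+-monoʳ-≤ t (m≤m+n t (q * t)))))

module FiniteAbelianGroup {n : ℕ} {_∙_ : Fin n → Fin n → Fin n} {ε : Fin n} {_⁻¹ : Fin n → Fin n}
                          (isAbelianGroup : IsAbelianGroup _≡_ _∙_ ε _⁻¹) where

  open GroupDefs _∙_ ε _⁻¹
  open IsAbelianGroup isAbelianGroup using (assoc; comm; identityˡ; identityʳ; inverseʳ)

  private
    abelianGroup : AbelianGroup 0ℓ 0ℓ
    abelianGroup = record { _≈_ = _≡_ ; _∙_ = _∙_ ; ε = ε ; _⁻¹ = _⁻¹ ; isAbelianGroup = isAbelianGroup }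
  open GroupProperties (AbelianGroup.group abelianGroup)
    using (∙-cancelˡ; ⁻¹-involutive; //-rightDividesʳ; \\-leftDividesˡ; \\-leftDividesʳ)
  open CommutativeSemigroupProperties (AbelianGroup.commutativeSemigroup abelianGroup)
    using (interchange)

  -- Subgroups and cyclic subgroups

  ∙-self-cancel : ∀ {a} w → a ∙ a ≡ ε → a ∙ (a ∙ w) ≡ w
  ∙-self-cancel {a} w a∙a≡ε = trans (sym (assoc a a w)) (trans (cong (_∙ w) a∙a≡ε) (identityˡ w))

  pow-+ : ∀ g i j → pow g (i + j) ≡ pow g i ∙ pow g j
  pow-+ g zero j = sym (identityˡ _)
  pow-+ g (suc i) j = trans (cong (g ∙_) (pow-+ g i j)) (sym (assoc _ _ _))

  pow-*≡ε : ∀ g m q → pow g m ≡ ε → pow g (q * m) ≡ ε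
  pow-*≡ε g m zero gᵐ≡ε = refl
  pow-*≡ε g m (suc q) gᵐ≡ε =
    trans (pow-+ g m (q * m)) (trans (cong₂ _∙_ gᵐ≡ε (pow-*≡ε g m q gᵐ≡ε)) (identityˡ ε))

  pow-% : ∀ g m k .{{_ : NonZero m}} → pow g m ≡ ε → pow g k ≡ pow g (k % m)
  pow-% g m k gᵐ≡ε = begin
    pow g k                             ≡⟨ cong (pow g) (m≡m%n+[m/n]*n k m) ⟩
    pow g (k % m + (k / m) * m)         ≡⟨ pow-+ g (k % m) ((k / m) * m) ⟩
    pow g (k % m) ∙ pow g ((k / m) * m) ≡⟨ cong (pow g (k % m) ∙_) (pow-*≡ε g m (k / m) gᵐ≡ε) ⟩
    pow g (k % m) ∙ ε                   ≡⟨ identityʳ _ ⟩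
    pow g (k % m)                       ∎
    where open ≡-Reasoning

  pow-≡⇒pow-∸≡ε : ∀ g {i j} → i ≤ j → pow g i ≡ pow g j → pow g (j ∸ i) ≡ ε
  pow-≡⇒pow-∸≡ε g {i} {j} i≤j gⁱ≡gʲ = sym (∙-cancelˡ (pow g i) ε (pow g (j ∸ i)) (begin
    pow g i ∙ ε             ≡⟨ identityʳ _ ⟩
    pow g i                 ≡⟨ gⁱ≡gʲ ⟩
    pow g j                 ≡⟨ cong (pow g) (m+[n∸m]≡n i≤j) ⟨
    pow g (i + (j ∸ i))     ≡⟨ pow-+ g i (j ∸ i) ⟩
    pow g i ∙ pow g (j ∸ i) ∎))
    where open ≡-Reasoning

  module Subgroup {H : Subset n} (isSubgroup : IsSubgroup H) where

    ε∈ : ε ∈ H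
    ε∈ = proj₁ isSubgroup

    ∙-closed : ∀ {x y} → x ∈ H → y ∈ H → x ∙ y ∈ H
    ∙-closed = proj₁ (proj₂ isSubgroup) _ _

    ⁻¹-closed : ∀ {x} → x ∈ H → x ⁻¹ ∈ H
    ⁻¹-closed = proj₂ (proj₂ isSubgroup) _

    pow-closed : ∀ {g} → g ∈ H → ∀ k → pow g k ∈ H
    pow-closed g∈H zero = ε∈
    pow-closed g∈H (suc k) = ∙-closed g∈H (pow-closed g∈H k)

    ∈-cancelʳ : ∀ {a w} → a ∙ w ∈ H → w ∈ H → a ∈ H
    ∈-cancelʳ {a} {w} a∙w∈H w∈H = subst (_∈ H) (//-rightDividesʳ w a) (∙-closed a∙w∈H (⁻¹-closed w∈H))

    0<∣H∣ : 0 < ∣ H ∣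
    0<∣H∣ = Unique⇒length≤∣ H ∣ {[ ε ]} ([] ∷ []) (λ { (here refl) → ε∈ })

  Generates : Fin n → Subset n → Set
  Generates h H = h ∈ H × (∀ {D} → IsSubgroup D → h ∈ D → H ⊆ D)

  Generates-unique : ∀ {h H H′} → IsSubgroup H → IsSubgroup H′ → Generates h H → Generates h H′ → H ≡ H′
  Generates-unique H≤ H′≤ (h∈H , H-least) (h∈H′ , H′-least) = ⊆-antisym (H-least H′≤ h∈H′) (H′-least H≤ h∈H)

  module Cyclic {C : Subset n} (isSubgroup : IsSubgroup C) {g : Fin n} (g∈C : g ∈ C)
                (generated : ∀ x → x ∈ C → ∃ λ k → x ≡ pow g k) where

    open Subgroup isSubgroup

    private
      instance
        ∣C∣-nonZero : NonZero ∣ C ∣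
        ∣C∣-nonZero = >-nonZero 0<∣H∣

    generates-generator : Generates g C
    generates-generator = g∈C , λ D≤ g∈D x∈C →
      let k , x≡gᵏ = generated _ x∈C in subst (_∈ _) (sym x≡gᵏ) (Subgroup.pow-closed D≤ g∈D k)

    generates-inverse : Generates (g ⁻¹) C
    generates-inverse = ⁻¹-closed g∈C , λ D≤ g⁻¹∈D →
      proj₂ generates-generator D≤ (subst (_∈ _) (⁻¹-involutive g) (Subgroup.⁻¹-closed D≤ g⁻¹∈D))

    ∣C∣≤period : ∀ {m} → 0 < m → pow g m ≡ ε → ∣ C ∣ ≤ m
    ∣C∣≤period {m} 0<m gᵐ≡ε = subst (∣ C ∣ ≤_) (length-applyUpTo (pow g) m) (∣ C ∣≤length λ {x} x∈C →
      let k , x≡gᵏ = generated x x∈C in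
      subst (_∈ₗ applyUpTo (pow g) m) (sym (trans x≡gᵏ (pow-% g m k gᵐ≡ε))) (∈-applyUpTo⁺ (pow g) (m%n<n k m)))
      where instance _ = >-nonZero 0<m

    -- If g^|C| ≠ 1 then g^0, …, g^|C| would be |C| + 1 distinct elements of C.
    pow-∣C∣≡ε : pow g ∣ C ∣ ≡ ε
    pow-∣C∣≡ε = decidable-stable (pow g ∣ C ∣ ≟ ε) λ gᵗ≢ε →
      let distinct : Unique (applyUpTo (pow g) (suc ∣ C ∣))
          distinct = Unique.applyUpTo⁺₁ (pow g) (suc ∣ C ∣) λ {i} {j} i<j j<1+t gⁱ≡gʲ →
            let gʲ⁻ⁱ≡ε = pow-≡⇒pow-∸≡ε g (<⇒≤ i<j) gⁱ≡gʲ
                j∸i≡t = ≤-antisym (≤-trans (m∸n≤m j i) (≤-pred j<1+t)) (∣C∣≤period (m<n⇒0<n∸m i<j) gʲ⁻ⁱ≡ε)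
            in gᵗ≢ε (subst (λ m → pow g m ≡ ε) j∸i≡t gʲ⁻ⁱ≡ε)
      in <-irrefl refl (subst (_≤ ∣ C ∣) (length-applyUpTo (pow g) (suc ∣ C ∣))
           (Unique⇒length≤∣ C ∣ distinct λ p →
             let k , _ , x≡gᵏ = ∈-applyUpTo⁻ (pow g) p in subst (_∈ C) (sym x≡gᵏ) (pow-closed g∈C k)))

    pow≡ε⇒∣C∣∣ : ∀ m → pow g m ≡ ε → ∣ C ∣ ∣ m
    pow≡ε⇒∣C∣∣ m gᵐ≡ε = m%n≡0⇒n∣m m ∣ C ∣
      (remainder≡0 (m % ∣ C ∣) (m%n<n m ∣ C ∣) (trans (sym (pow-% g ∣ C ∣ m pow-∣C∣≡ε)) gᵐ≡ε))
      where
        remainder≡0 : ∀ r → r < ∣ C ∣ → pow g r ≡ ε → r ≡ 0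
        remainder≡0 zero _ _ = refl
        remainder≡0 (suc r) r<∣C∣ gʳ≡ε = contradiction (∣C∣≤period z<s gʳ≡ε) (<⇒≱ r<∣C∣)

    involution-index : ∀ {c} → c ∈ C → c ∙ c ≡ ε → c ≢ ε → ∃ λ a → c ≡ pow g a × a + a ≡ ∣ C ∣
    involution-index {c} c∈C c²≡ε c≢ε =
      let k , c≡gᵏ = generated c c∈C
          a = k % ∣ C ∣
          c≡gᵃ = trans c≡gᵏ (pow-% g ∣ C ∣ k pow-∣C∣≡ε)
          g²ᵃ≡ε = trans (pow-+ g a a) (trans (cong₂ _∙_ (sym c≡gᵃ) (sym c≡gᵃ)) c²≡ε)
      in a , c≡gᵃ , fromInj₂ (λ a≡0 → contradiction (trans c≡gᵃ (cong (pow g) a≡0)) c≢ε)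
                      (half-of-multiple (m%n<n k ∣ C ∣) (pow≡ε⇒∣C∣∣ (a + a) g²ᵃ≡ε))

    involution-unique : ∀ {c d} → c ∈ C → d ∈ C → c ∙ c ≡ ε → d ∙ d ≡ ε → c ≢ ε → d ≢ ε → c ≡ d
    involution-unique c∈C d∈C c²≡ε d²≡ε c≢ε d≢ε =
      let a , c≡gᵃ , 2a≡t = involution-index c∈C c²≡ε c≢ε
          b , d≡gᵇ , 2b≡t = involution-index d∈C d²≡ε d≢ε
          a≡b = *-cancelˡ-≡ a b 2 (trans (double a) (trans (trans 2a≡t (sym 2b≡t)) (sym (double b))))
      in trans c≡gᵃ (trans (cong (pow g) a≡b) (sym d≡gᵇ))
      where
        double : ∀ m → 2 * m ≡ m + m
        double m = cong (m +_) (+-identityʳ m)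

    generator²≢ε : 2 < ∣ C ∣ → g ∙ g ≢ ε
    generator²≢ε 2<∣C∣ g²≡ε =
      <⇒≱ 2<∣C∣ (∣C∣≤period {2} z<s (trans (cong (g ∙_) (identityʳ g)) g²≡ε))

    generator≢inverse : 2 < ∣ C ∣ → g ≢ g ⁻¹
    generator≢inverse 2<∣C∣ g≡g⁻¹ = generator²≢ε 2<∣C∣ (trans (cong (g ∙_) g≡g⁻¹) (inverseʳ g))

  record IsLargeCyclic (C : Subset n) : Set where
    field
      isSubgroup : IsSubgroup C
      generator : Fin n
      generator∈C : generator ∈ C
      generated : ∀ x → x ∈ C → ∃ λ k → x ≡ pow generator k
      4≤∣C∣ : 4 ≤ ∣ C ∣

    open Cyclic isSubgroup generator∈C generated public

    generator≢generator⁻¹ : generator ≢ generator ⁻¹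
    generator≢generator⁻¹ = generator≢inverse (≤-trans (n≤1+n 3) 4≤∣C∣)

  private
    generatorPairs : ∀ Cs → All IsLargeCyclic Cs → List (Fin n)
    generatorPairs [] [] = []
    generatorPairs (_ ∷ Cs) (C-cyclic ∷ Cs-cyclic) = generator ∷ generator ⁻¹ ∷ generatorPairs Cs Cs-cyclic
      where open IsLargeCyclic C-cyclic

    length-generatorPairs : ∀ Cs Cs-cyclic → length (generatorPairs Cs Cs-cyclic) ≡ 2 * length Cs
    length-generatorPairs [] [] = refl
    length-generatorPairs (_ ∷ Cs) (_ ∷ Cs-cyclic) =
      trans (cong (λ m → suc (suc m)) (length-generatorPairs Cs Cs-cyclic)) (sym (*-distribˡ-+ 2 1 (length Cs)))

    ∈-generatorPairs⁻ : ∀ Cs Cs-cyclic {h} → h ∈ₗ generatorPairs Cs Cs-cyclic →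
      ∃ λ C → C ∈ₗ Cs × IsSubgroup C × Generates h C
    ∈-generatorPairs⁻ (C ∷ _) (C-cyclic ∷ _) (here refl) = C , here refl , isSubgroup , generates-generator
      where open IsLargeCyclic C-cyclic
    ∈-generatorPairs⁻ (C ∷ _) (C-cyclic ∷ _) (there (here refl)) = C , here refl , isSubgroup , generates-inverse
      where open IsLargeCyclic C-cyclic
    ∈-generatorPairs⁻ (_ ∷ Cs) (_ ∷ Cs-cyclic) (there (there p)) =
      let C , C∈Cs , rest = ∈-generatorPairs⁻ Cs Cs-cyclic p in C , there C∈Cs , rest

    generatorPairs-Unique : ∀ Cs Cs-cyclic → Unique Cs → Unique (generatorPairs Cs Cs-cyclic)
    generatorPairs-Unique [] [] _ = []
    generatorPairs-Unique (C ∷ Cs) (C-cyclic ∷ Cs-cyclic) (C∉Cs ∷ u) =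
        (generator≢generator⁻¹ ∷ All.tabulate (generates-nothing-else generates-generator))
      ∷ All.tabulate (generates-nothing-else generates-inverse)
      ∷ generatorPairs-Unique Cs Cs-cyclic u
      where
        open IsLargeCyclic C-cyclic
        generates-nothing-else : ∀ {h h′} → Generates h C → h′ ∈ₗ generatorPairs Cs Cs-cyclic → h ≢ h′
        generates-nothing-else gen-C p refl =
          let C′ , C′∈Cs , C′≤ , gen-C′ = ∈-generatorPairs⁻ Cs Cs-cyclic p
          in All.lookup C∉Cs C′∈Cs (Generates-unique isSubgroup C′≤ gen-C gen-C′)

  2*#largeCyclic≤n : ∀ Cs → Unique Cs → All IsLargeCyclic Cs → 2 * length Cs ≤ n
  2*#largeCyclic≤n Cs u Cs-cyclic =
    subst (_≤ n) (length-generatorPairs Cs Cs-cyclic) (Unique⇒length≤n (generatorPairs-Unique Cs Cs-cyclic u))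

  module DirectProduct {C Z : Subset n} (C≤ : IsSubgroup C) (Z≤ : IsSubgroup Z)
                       (C∩Z≡1 : ∀ x → x ∈ C → x ∈ Z → x ≡ ε) where

    factor-unique : ∀ {c c′ z z′} → c ∈ C → c′ ∈ C → z ∈ Z → z′ ∈ Z → c ∙ z ≡ c′ ∙ z′ → c ≡ c′ × z ≡ z′
    factor-unique {c} {c′} {z} {z′} c∈C c′∈C z∈Z z′∈Z cz≡c′z′ =
      c≡c′ , ∙-cancelˡ c z z′ (trans cz≡c′z′ (cong (_∙ z′) (sym c≡c′)))
      where
        w∙z≡z′ : ((c′ ⁻¹) ∙ c) ∙ z ≡ z′
        w∙z≡z′ = trans (assoc _ _ _) (trans (cong ((c′ ⁻¹) ∙_) cz≡c′z′) (\\-leftDividesʳ c′ z′))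
        w≡ε : (c′ ⁻¹) ∙ c ≡ ε
        w≡ε = C∩Z≡1 _ (Subgroup.∙-closed C≤ (Subgroup.⁻¹-closed C≤ c′∈C) c∈C)
                      (Subgroup.∈-cancelʳ Z≤ (subst (_∈ Z) (sym w∙z≡z′) z′∈Z) z∈Z)
        c≡c′ : c ≡ c′
        c≡c′ = begin
          c                  ≡⟨ \\-leftDividesˡ c′ c ⟨
          c′ ∙ ((c′ ⁻¹) ∙ c) ≡⟨ cong (c′ ∙_) w≡ε ⟩
          c′ ∙ ε             ≡⟨ identityʳ c′ ⟩
          c′                 ∎
          where open ≡-Reasoning

    ∣C∣*∣Z∣≤n : ∣ C ∣ * ∣ Z ∣ ≤ n
    ∣C∣*∣Z∣≤n = subst (_≤ n) length-products (Unique⇒length≤n products-Unique)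
      where
        pairs = cartesianProduct (elements C) (elements Z)
        products = map (uncurry _∙_) pairs

        length-products : length products ≡ ∣ C ∣ * ∣ Z ∣
        length-products = trans (length-map _ pairs) (trans (length-cartesianProduct (elements C) (elements Z))
          (cong₂ _*_ (length-elements C) (length-elements Z)))

        products-Unique : Unique products
        products-Unique = Unique-map⁺ (Unique.cartesianProduct⁺ (elements-Unique C) (elements-Unique Z))
          λ p q eq →
            let c∈ , z∈ = ∈-cartesianProduct⁻ (elements C) (elements Z) p
                c′∈ , z′∈ = ∈-cartesianProduct⁻ (elements C) (elements Z) q
            in uncurry (cong₂ _,_)
                 (factor-unique (∈-elements⁻ c∈) (∈-elements⁻ c′∈) (∈-elements⁻ z∈) (∈-elements⁻ z′∈) eq)

  -- Characters of an elementary abelian 2-group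

  _·_ : Fin n → Subset n → Subset n
  x · S = tabulate (λ w → lookup S (x ∙ w))

  ∈-·⁺ : ∀ {x w S} → x ∙ w ∈ S → w ∈ x · S
  ∈-·⁺ {x} {w} {S} x∙w∈S = lookup≡true⇒∈ (trans (lookup∘tabulate _ w) ([]=⇒lookup x∙w∈S))

  ∈-·⁻ : ∀ {x w S} → w ∈ x · S → x ∙ w ∈ S
  ∈-·⁻ {x} {w} {S} w∈x·S = lookup≡true⇒∈ (trans (sym (lookup∘tabulate _ w)) ([]=⇒lookup w∈x·S))

  -- A character of S (a homomorphism S → ℤ/2) is encoded by its support K, read through lookup K.
  IsCharacterOn : Subset n → Subset n → Set
  IsCharacterOn S K = K ⊆ S × (∀ {x y} → x ∈ S → y ∈ S → lookup K (x ∙ y) ≡ lookup K x xor lookup K y)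

  CharacterBound : Subset n → Set
  CharacterBound S = ∀ Ks → Unique Ks → All (IsCharacterOn S) Ks → length Ks ≤ ∣ S ∣

  module Characters {Z₀ : Subset n} (Z₀≤ : IsSubgroup Z₀) (Z₀-elementary : IsElemAbelian2 Z₀) where

    IsSubmonoid : Subset n → Set
    IsSubmonoid S = ε ∈ S × (∀ {x y} → x ∈ S → y ∈ S → x ∙ y ∈ S) × S ⊆ Z₀

    singleton-submonoid : IsSubmonoid ⁅ ε ⁆
    singleton-submonoid = x∈⁅x⁆ ε , ∙-closed , λ x∈⁅ε⁆ → subst (_∈ Z₀) (sym (x∈⁅y⁆⇒x≡y ε x∈⁅ε⁆)) (Subgroup.ε∈ Z₀≤)
      where
        ∙-closed : ∀ {x y} → x ∈ ⁅ ε ⁆ → y ∈ ⁅ ε ⁆ → x ∙ y ∈ ⁅ ε ⁆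
        ∙-closed x∈⁅ε⁆ y∈⁅ε⁆ rewrite x∈⁅y⁆⇒x≡y ε x∈⁅ε⁆ | x∈⁅y⁆⇒x≡y ε y∈⁅ε⁆ | identityˡ ε = x∈⁅x⁆ ε

    singleton-bound : CharacterBound ⁅ ε ⁆
    singleton-bound Ks u Ks-char = subst (length Ks ≤_) (sym (∣⁅x⁆∣≡1 ε))
      (Unique-⊆⇒length≤ {ys = [ ⊥ ]} u (λ p → here (trivial (All.lookup Ks-char p))))
      where
        trivial : ∀ {K} → IsCharacterOn ⁅ ε ⁆ K → K ≡ ⊥
        trivial {K} (K⊆⁅ε⁆ , hom) = Empty-unique λ (x , x∈K) →
          lookup≡false⇒∉ Kε≡false (subst (_∈ K) (x∈⁅y⁆⇒x≡y ε (K⊆⁅ε⁆ x∈K)) x∈K)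
          where
            Kε≡false : lookup K ε ≡ false
            Kε≡false = begin
              lookup K ε                ≡⟨ cong (lookup K) (identityˡ ε) ⟨
              lookup K (ε ∙ ε)          ≡⟨ hom (x∈⁅x⁆ ε) (x∈⁅x⁆ ε) ⟩
              lookup K ε xor lookup K ε ≡⟨ xor-same (lookup K ε) ⟩
              false                     ∎
              where open ≡-Reasoning

    module Extension {S : Subset n} (S-sub : IsSubmonoid S) {x : Fin n} (x∈Z₀ : x ∈ Z₀) (x∉S : x ∉ S) where

      private
        ε∈S = proj₁ S-sub
        ∙-closed = proj₁ (proj₂ S-sub)
        S⊆Z₀ = proj₂ (proj₂ S-sub)
        x²≡ε = Z₀-elementary x x∈Z₀

      S′ : Subset n
      S′ = S ∪ x · S

      S⊆S′ : S ⊆ S′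
      S⊆S′ = p⊆p∪q (x · S)

      x·S⊆S′ : x · S ⊆ S′
      x·S⊆S′ = q⊆p∪q S (x · S)

      x∈S′ : x ∈ S′
      x∈S′ = x·S⊆S′ (∈-·⁺ (subst (_∈ S) (sym x²≡ε) ε∈S))

      S⊂S′ : S ⊂ S′
      S⊂S′ = S⊆S′ , x , x∈S′ , x∉S

      S′-submonoid : IsSubmonoid S′
      S′-submonoid = S⊆S′ ε∈S , closed , S′⊆Z₀
        where
          closed : ∀ {a b} → a ∈ S′ → b ∈ S′ → a ∙ b ∈ S′
          closed {a} {b} a∈ b∈ with x∈p∪q⁻ S (x · S) a∈ | x∈p∪q⁻ S (x · S) b∈
          ... | inj₁ a∈S | inj₁ b∈S = S⊆S′ (∙-closed a∈S b∈S)
          ... | inj₁ a∈S | inj₂ b∈xS = x·S⊆S′ (∈-·⁺ (subst (_∈ S) a∙[x∙b]≡x∙[a∙b] (∙-closed a∈S (∈-·⁻ b∈xS))))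
            where a∙[x∙b]≡x∙[a∙b] = trans (sym (assoc a x b)) (trans (cong (_∙ b) (comm a x)) (assoc x a b))
          ... | inj₂ a∈xS | inj₁ b∈S = x·S⊆S′ (∈-·⁺ (subst (_∈ S) (assoc x a b) (∙-closed (∈-·⁻ a∈xS) b∈S)))
          ... | inj₂ a∈xS | inj₂ b∈xS = S⊆S′ (subst (_∈ S) [x∙a]∙[x∙b]≡a∙b (∙-closed (∈-·⁻ a∈xS) (∈-·⁻ b∈xS)))
            where [x∙a]∙[x∙b]≡a∙b = trans (interchange x a x b) (trans (cong (_∙ (a ∙ b)) x²≡ε) (identityˡ _))

          S′⊆Z₀ : S′ ⊆ Z₀
          S′⊆Z₀ {w} w∈ with x∈p∪q⁻ S (x · S) w∈
          ... | inj₁ w∈S = S⊆Z₀ w∈S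
          ... | inj₂ w∈xS = subst (_∈ Z₀) (∙-self-cancel w x²≡ε)
                              (Subgroup.∙-closed Z₀≤ x∈Z₀ (S⊆Z₀ (∈-·⁻ w∈xS)))

      ∣S∣+∣S∣≤∣S′∣ : ∣ S ∣ + ∣ S ∣ ≤ ∣ S′ ∣
      ∣S∣+∣S∣≤∣S′∣ = subst (_≤ ∣ S′ ∣) length-both (Unique⇒length≤∣ S′ ∣ both-Unique both⊆S′)
        where
          both = elements S ++ map (x ∙_) (elements S)

          length-both : length both ≡ ∣ S ∣ + ∣ S ∣
          length-both = trans (length-++ (elements S))
            (cong₂ _+_ (length-elements S) (trans (length-map _ (elements S)) (length-elements S)))

          -- s = x ∙ s′ with s, s′ ∈ S would give x = s ∙ s′ ∈ S.
          both-Unique : Unique both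
          both-Unique = Unique.++⁺ (elements-Unique S) (Unique.map⁺ (∙-cancelˡ x _ _) (elements-Unique S))
            λ { (s∈ , xs′∈) → let s′ , s′∈ , s≡x∙s′ = ∈-map⁻ (x ∙_) xs′∈
                                  s′∈S = ∈-elements⁻ s′∈
                                  s∙s′≡x = trans (cong (_∙ s′) s≡x∙s′) (trans (assoc x _ _)
                                             (trans (cong (x ∙_) (Z₀-elementary _ (S⊆Z₀ s′∈S))) (identityʳ x)))
                              in x∉S (subst (_∈ S) s∙s′≡x (∙-closed (∈-elements⁻ s∈) s′∈S)) }

          both⊆S′ : ∀ {w} → w ∈ₗ both → w ∈ S′
          both⊆S′ w∈ with ∈-++⁻ (elements S) w∈
          ... | inj₁ w∈S = S⊆S′ (∈-elements⁻ w∈S)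
          ... | inj₂ w∈xS = let s , s∈ , w≡x∙s = ∈-map⁻ (x ∙_) w∈xS in
            x·S⊆S′ (∈-·⁺ (subst (_∈ S) (sym (trans (cong (x ∙_) w≡x∙s) (∙-self-cancel s x²≡ε)))
                                  (∈-elements⁻ s∈)))

      restrict-character : ∀ {K} → IsCharacterOn S′ K → IsCharacterOn S (K ∩ S)
      restrict-character {K} (_ , hom) = p∩q⊆q K S , λ {a} {b} a∈S b∈S → begin
        lookup (K ∩ S) (a ∙ b)                ≡⟨ lookup-∩-∈ʳ K (∙-closed a∈S b∈S) ⟩
        lookup K (a ∙ b)                      ≡⟨ hom (S⊆S′ a∈S) (S⊆S′ b∈S) ⟩
        lookup K a xor lookup K b             ≡⟨ cong₂ _xor_ (lookup-∩-∈ʳ K a∈S) (lookup-∩-∈ʳ K b∈S) ⟨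
        lookup (K ∩ S) a xor lookup (K ∩ S) b ∎
        where open ≡-Reasoning

      restrict-injective : ∀ {K K′} → IsCharacterOn S′ K → IsCharacterOn S′ K′ →
        lookup K x ≡ lookup K′ x → K ∩ S ≡ K′ ∩ S → K ≡ K′
      restrict-injective {K} {K′} (K⊆S′ , hom) (K′⊆S′ , hom′) Kx≡K′x K∩S≡K′∩S = Subset-ext agree
        where
          agree-on-S : ∀ {w} → w ∈ S → lookup K w ≡ lookup K′ w
          agree-on-S {w} w∈S =
            trans (sym (lookup-∩-∈ʳ K w∈S)) (trans (cong (λ L → lookup L w) K∩S≡K′∩S) (lookup-∩-∈ʳ K′ w∈S))

          agree : ∀ w → lookup K w ≡ lookup K′ w
          agree w with w ∈? S | x ∙ w ∈? S
          ... | yes w∈S | _ = agree-on-S w∈S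
          ... | no _ | yes x∙w∈S = begin
            lookup K w                        ≡⟨ cong (lookup K) (∙-self-cancel w x²≡ε) ⟨
            lookup K (x ∙ (x ∙ w))            ≡⟨ hom x∈S′ (S⊆S′ x∙w∈S) ⟩
            lookup K x xor lookup K (x ∙ w)   ≡⟨ cong₂ _xor_ Kx≡K′x (agree-on-S x∙w∈S) ⟩
            lookup K′ x xor lookup K′ (x ∙ w) ≡⟨ hom′ x∈S′ (S⊆S′ x∙w∈S) ⟨
            lookup K′ (x ∙ (x ∙ w))           ≡⟨ cong (lookup K′) (∙-self-cancel w x²≡ε) ⟩
            lookup K′ w                       ∎
            where open ≡-Reasoning
          ... | no w∉S | no x∙w∉S = trans (∉⇒lookup≡false (w∉S′ ∘ K⊆S′)) (sym (∉⇒lookup≡false (w∉S′ ∘ K′⊆S′)))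
            where
              w∉S′ : w ∉ S′
              w∉S′ w∈S′ = [ w∉S , x∙w∉S ∘ ∈-·⁻ ]′ (x∈p∪q⁻ S (x · S) w∈S′)

      extend-bound : CharacterBound S → CharacterBound S′
      extend-bound S-bound Ks u Ks-char = begin
        length Ks
          ≡⟨ length-filter-∁ (x ∈?_) Ks ⟩
        length (filter (x ∈?_) Ks) + length (filter (¬? ∘ (x ∈?_)) Ks)
          ≤⟨ +-mono-≤
               (fibre (x ∈?_) λ x∈K x∈K′ → trans ([]=⇒lookup x∈K) (sym ([]=⇒lookup x∈K′)))
               (fibre (¬? ∘ (x ∈?_)) λ x∉K x∉K′ → trans (∉⇒lookup≡false x∉K) (sym (∉⇒lookup≡false x∉K′))) ⟩
        ∣ S ∣ + ∣ S ∣
          ≤⟨ ∣S∣+∣S∣≤∣S′∣ ⟩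
        ∣ S′ ∣ ∎
        where
          open ≤-Reasoning
          fibre : ∀ {P : Subset n → Set} (P? : Decidable P) →
            (∀ {K K′} → P K → P K′ → lookup K x ≡ lookup K′ x) → length (filter P? Ks) ≤ ∣ S ∣
          fibre P? same = subst (_≤ ∣ S ∣) (length-map (_∩ S) (filter P? Ks))
            (S-bound (map (_∩ S) (filter P? Ks))
              (Unique-map⁺ (Unique.filter⁺ P? u) λ p q →
                let K∈ , PK = ∈-filter⁻ P? p
                    K′∈ , PK′ = ∈-filter⁻ P? q
                in restrict-injective (All.lookup Ks-char K∈) (All.lookup Ks-char K′∈) (same PK PK′))
              (All.map⁺ (All.map restrict-character (All.filter⁺ P? Ks-char))))

    -- Adjoining an element of Z₀ ∖ S doubles |S| and at most doubles the number of characters.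
    characterBound : CharacterBound Z₀
    characterBound = grow (⊃-wellFounded ⁅ ε ⁆) singleton-submonoid singleton-bound
      where
        grow : ∀ {S} → Acc _⊃_ S → IsSubmonoid S → CharacterBound S → CharacterBound Z₀
        grow {S} (acc larger) S-sub S-bound with any? (λ x → (x ∈? Z₀) ×-dec ¬? (x ∈? S))
        ... | yes (x , x∈Z₀ , x∉S) = grow (larger S⊂S′) S′-submonoid (extend-bound S-bound)
          where open Extension S-sub x∈Z₀ x∉S
        ... | no ∄x = subst CharacterBound S≡Z₀ S-bound
          where
            S≡Z₀ : S ≡ Z₀
            S≡Z₀ = ⊆-antisym (proj₂ (proj₂ S-sub))
                     (λ {z} z∈Z₀ → decidable-stable (z ∈? S) (λ z∉S → ∄x (z , z∈Z₀ , z∉S)))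

  -- Elementary abelian complements of a large cyclic subgroup

  IsElementaryComplement : Subset n → Subset n → Set
  IsElementaryComplement C Z = IsSubgroup Z × IsInternalDirectProduct C Z × IsElemAbelian2 Z

  module Complements {C : Subset n} (C-cyclic : IsLargeCyclic C) where

    open IsLargeCyclic C-cyclic using (involution-unique; 4≤∣C∣) renaming (isSubgroup to C≤)

    decompose-involution : ∀ {Z y} → IsElementaryComplement C Z → y ∙ y ≡ ε →
      ∃ λ c → ∃ λ w → c ∈ C × w ∈ Z × y ≡ c ∙ w × c ∙ c ≡ ε
    decompose-involution {y = y} (_ , (_ , decompose) , Z-elementary) y²≡ε with decompose y
    ... | c , w , c∈C , w∈Z , y≡c∙w = c , w , c∈C , w∈Z , y≡c∙w , (begin
      c ∙ c               ≡⟨ identityʳ _ ⟨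
      (c ∙ c) ∙ ε         ≡⟨ cong ((c ∙ c) ∙_) (Z-elementary w w∈Z) ⟨
      (c ∙ c) ∙ (w ∙ w)   ≡⟨ interchange c c w w ⟩
      (c ∙ w) ∙ (c ∙ w)   ≡⟨ cong₂ _∙_ y≡c∙w y≡c∙w ⟨
      y ∙ y               ≡⟨ y²≡ε ⟩
      ε                   ∎)
      where open ≡-Reasoning

    nontrivial-component : ∀ {Z y c w} → w ∈ Z → y ∉ Z → y ≡ c ∙ w → c ≢ ε
    nontrivial-component {Z} w∈Z y∉Z y≡c∙w refl = y∉Z (subst (_∈ Z) (sym (trans y≡c∙w (identityˡ _))) w∈Z)

    -- x and y both have the unique involution of C as C-component, and it cancels in x ∙ y.
    ∉∙∉⇒∈ : ∀ {Z x y} → IsElementaryComplement C Z → x ∙ x ≡ ε → y ∙ y ≡ ε → x ∉ Z → y ∉ Z → x ∙ y ∈ Z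
    ∉∙∉⇒∈ {Z} {x} {y} Z-compl x²≡ε y²≡ε x∉Z y∉Z
      with decompose-involution Z-compl x²≡ε | decompose-involution Z-compl y²≡ε
    ... | c , w , c∈C , w∈Z , x≡c∙w , c²≡ε | d , v , d∈C , v∈Z , y≡d∙v , d²≡ε =
      subst (_∈ Z) (sym x∙y≡w∙v) (Subgroup.∙-closed (proj₁ Z-compl) w∈Z v∈Z)
      where
        c≡d = involution-unique c∈C d∈C c²≡ε d²≡ε
                (nontrivial-component w∈Z x∉Z x≡c∙w) (nontrivial-component v∈Z y∉Z y≡d∙v)
        x∙y≡w∙v : x ∙ y ≡ w ∙ v
        x∙y≡w∙v = begin
          x ∙ y               ≡⟨ cong₂ _∙_ x≡c∙w (trans y≡d∙v (cong (_∙ v) (sym c≡d))) ⟩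
          (c ∙ w) ∙ (c ∙ v)   ≡⟨ interchange c w c v ⟩
          (c ∙ c) ∙ (w ∙ v)   ≡⟨ cong (_∙ (w ∙ v)) c²≡ε ⟩
          ε ∙ (w ∙ v)         ≡⟨ identityˡ _ ⟩
          w ∙ v               ∎
          where open ≡-Reasoning

    4*∣Z∣≤n : ∀ {Z} → IsElementaryComplement C Z → 4 * ∣ Z ∣ ≤ n
    4*∣Z∣≤n (Z≤ , (C∩Z≡1 , _) , _) = ≤-trans (*-monoˡ-≤ _ 4≤∣C∣) (DirectProduct.∣C∣*∣Z∣≤n C≤ Z≤ C∩Z≡1)

    module RelativeTo {Z₀ : Subset n} (Z₀-compl : IsElementaryComplement C Z₀) where

      private
        Z₀≤ = proj₁ Z₀-compl
        Z₀-elementary = proj₂ (proj₂ Z₀-compl)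

      defect : Subset n → Subset n
      defect Z = Z₀ ∩ ∁ Z

      defect-character : ∀ {Z} → IsElementaryComplement C Z → IsCharacterOn Z₀ (defect Z)
      defect-character {Z} Z-compl@(Z≤ , _) = p∩q⊆p Z₀ (∁ Z) , λ {x} {y} x∈Z₀ y∈Z₀ → begin
        lookup (defect Z) (x ∙ y)                   ≡⟨ lookup-∩∁-∈ (Subgroup.∙-closed Z₀≤ x∈Z₀ y∈Z₀) ⟩
        not (lookup Z (x ∙ y))                      ≡⟨ not-xor-not
          (via-∈ (Subgroup.∙-closed Z≤))
          (via-∈ λ x∈Z x∙y∈Z → Subgroup.∈-cancelʳ Z≤ (subst (_∈ Z) (comm x y) x∙y∈Z) x∈Z)
          (via-∈ λ y∈Z x∙y∈Z → Subgroup.∈-cancelʳ Z≤ x∙y∈Z y∈Z)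
          (via-∉ (∉∙∉⇒∈ Z-compl (Z₀-elementary x x∈Z₀) (Z₀-elementary y y∈Z₀))) ⟩
        not (lookup Z x) xor not (lookup Z y)       ≡⟨ cong₂ _xor_ (lookup-∩∁-∈ x∈Z₀) (lookup-∩∁-∈ y∈Z₀) ⟨
        lookup (defect Z) x xor lookup (defect Z) y ∎
        where
          open ≡-Reasoning
          via-∈ : ∀ {u v w} → (u ∈ Z → v ∈ Z → w ∈ Z) →
            lookup Z u ≡ true → lookup Z v ≡ true → lookup Z w ≡ true
          via-∈ closed Z[u] Z[v] = []=⇒lookup (closed (lookup≡true⇒∈ Z[u]) (lookup≡true⇒∈ Z[v]))
          via-∉ : ∀ {u v w} → (u ∉ Z → v ∉ Z → w ∈ Z) →
            lookup Z u ≡ false → lookup Z v ≡ false → lookup Z w ≡ true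
          via-∉ closed Z[u] Z[v] = []=⇒lookup (closed (lookup≡false⇒∉ Z[u]) (lookup≡false⇒∉ Z[v]))

      ∈-defect⁺ : ∀ {Z z} → z ∈ Z₀ → z ∉ Z → z ∈ defect Z
      ∈-defect⁺ z∈Z₀ z∉Z = x∈p∩q⁺ (z∈Z₀ , x∉p⇒x∈∁p z∉Z)

      ∈-defect⁻ : ∀ {Z z} → z ∈ defect Z → z ∉ Z
      ∈-defect⁻ {Z} z∈ = x∈∁p⇒x∉p (proj₂ (x∈p∩q⁻ Z₀ (∁ Z) z∈))

      -- Write z = c ∙ z₀ with c ∈ C and z₀ ∈ Z₀, so that c is 1 or the involution of C. If c ≠ 1
      -- then z₀ ∉ Z, hence z₀ ∉ Z′, so z₀ also has C-component c relative to Z′ and z ∈ Z′.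
      defect-⊆ : ∀ {Z Z′} → IsElementaryComplement C Z → IsElementaryComplement C Z′ →
        defect Z ≡ defect Z′ → Z ⊆ Z′
      defect-⊆ {Z} {Z′} (Z≤ , (C∩Z≡1 , _) , Z-elementary) Z′-compl same {z} z∈Z
        with decompose-involution Z₀-compl (Z-elementary z z∈Z)
      ... | c , z₀ , c∈C , z₀∈Z₀ , z≡c∙z₀ , c²≡ε with c ≟ ε
      ... | yes refl = subst (_∈ Z′) (sym z≡z₀) z₀∈Z′
        where
          z≡z₀ = trans z≡c∙z₀ (identityˡ z₀)
          z₀∈Z′ = decidable-stable (z₀ ∈? Z′) λ z₀∉Z′ →
            ∈-defect⁻ (subst (z₀ ∈_) (sym same) (∈-defect⁺ z₀∈Z₀ z₀∉Z′)) (subst (_∈ Z) z≡z₀ z∈Z)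
      ... | no c≢ε with decompose-involution Z′-compl (Z₀-elementary z₀ z₀∈Z₀)
      ...   | d , w , d∈C , w∈Z′ , z₀≡d∙w , d²≡ε = subst (_∈ Z′) (sym z≡w) w∈Z′
        where
          z₀∉Z : z₀ ∉ Z
          z₀∉Z z₀∈Z = c≢ε (C∩Z≡1 c c∈C (Subgroup.∈-cancelʳ Z≤ (subst (_∈ Z) z≡c∙z₀ z∈Z) z₀∈Z))
          z₀∉Z′ : z₀ ∉ Z′
          z₀∉Z′ = ∈-defect⁻ (subst (z₀ ∈_) same (∈-defect⁺ z₀∈Z₀ z₀∉Z))
          c≡d = involution-unique c∈C d∈C c²≡ε d²≡ε c≢ε (nontrivial-component w∈Z′ z₀∉Z′ z₀≡d∙w)
          z≡w : z ≡ w
          z≡w = begin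
            z             ≡⟨ z≡c∙z₀ ⟩
            c ∙ z₀        ≡⟨ cong (c ∙_) (trans z₀≡d∙w (cong (_∙ w) (sym c≡d))) ⟩
            c ∙ (c ∙ w)   ≡⟨ ∙-self-cancel w c²≡ε ⟩
            w             ∎
            where open ≡-Reasoning

      #complements≤∣Z₀∣ : ∀ Zs → Unique Zs → All (IsElementaryComplement C) Zs → length Zs ≤ ∣ Z₀ ∣
      #complements≤∣Z₀∣ Zs u Zs-compl = subst (_≤ ∣ Z₀ ∣) (length-map defect Zs)
        (characterBound (map defect Zs)
          (Unique-map⁺ u λ p q same →
            let Z-compl = All.lookup Zs-compl p
                Z′-compl = All.lookup Zs-compl q
            in ⊆-antisym (defect-⊆ Z-compl Z′-compl same) (defect-⊆ Z′-compl Z-compl (sym same)))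
          (All.map⁺ (All.map defect-character Zs-compl)))
        where open Characters Z₀≤ Z₀-elementary

  -- Counting the quadruples

  private
    _≟ₛ_ : DecidableEquality (Subset n)
    _≟ₛ_ = ≡-dec Bool._≟_

  S′-options : Subset n → List (Subset n)
  S′-options C = C ∷ ⊥ ∷ ⁅ ε ⁆ ∷ (C ∩ ∁ ⁅ ε ⁆) ∷ []

  ∈-S′-options : ∀ {C S′} → (S′ ≡ C) ⊎ (S′ ≡ ⊥) ⊎ (S′ ≡ ⁅ ε ⁆) ⊎ (S′ ≡ (C ∩ ∁ ⁅ ε ⁆)) → S′ ∈ₗ S′-options C
  ∈-S′-options (inj₁ refl) = here refl
  ∈-S′-options (inj₂ (inj₁ refl)) = there (here refl)
  ∈-S′-options (inj₂ (inj₂ (inj₁ refl))) = there (there (here refl))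
  ∈-S′-options (inj₂ (inj₂ (inj₂ refl))) = there (there (there (here refl)))

  Valid⇒IsLargeCyclic : ∀ {q} → Valid q → IsLargeCyclic (proj₁ q)
  Valid⇒IsLargeCyclic (C≤ , _ , _ , (t , 4≤t , (g , g∈C , generated) , ∣C∣≡t) , _) = record
    { isSubgroup = C≤ ; generator = g ; generator∈C = g∈C ; generated = generated
    ; 4≤∣C∣ = subst (4 ≤_) (sym ∣C∣≡t) 4≤t }

  Valid⇒IsElementaryComplement : ∀ {q} → Valid q → IsElementaryComplement (proj₁ q) (proj₁ (proj₂ q))
  Valid⇒IsElementaryComplement (_ , Z≤ , C×Z , _ , Z-elementary , _) = Z≤ , C×Z , Z-elementary

  #quadruples-over-C,Z : ∀ {C Z} ys → Unique ys →
    All (λ q → (Valid q × proj₁ q ≡ C) × proj₁ (proj₂ q) ≡ Z) ys → length ys ≤ 4 * 2 ^ ∣ Z ∣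
  #quadruples-over-C,Z {C} {Z} ys u ys-over =
    subst (length ys ≤_) length-candidates (Unique-⊆⇒length≤ u (candidate ∘ All.lookup ys-over))
    where
      extend : Subset n × Subset n → Quad
      extend (S′ , S″) = C , Z , S′ , S″

      candidates : List Quad
      candidates = map extend (cartesianProduct (S′-options C) (subsetsOf Z))

      length-candidates : length candidates ≡ 4 * 2 ^ ∣ Z ∣
      length-candidates = trans (length-map extend (cartesianProduct (S′-options C) (subsetsOf Z)))
        (trans (length-cartesianProduct (S′-options C) (subsetsOf Z)) (cong (4 *_) (length-subsetsOf Z)))

      candidate : ∀ {q} → (Valid q × proj₁ q ≡ C) × proj₁ (proj₂ q) ≡ Z → q ∈ₗ candidates
      candidate (((_ , _ , _ , _ , _ , S′-option , S″⊆Z) , refl) , refl) =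
        ∈-map⁺ extend (∈-cartesianProduct⁺ (∈-S′-options S′-option) (∈-subsetsOf S″⊆Z))

  ≤n/4 : ∀ {k} → 4 * k ≤ n → k ≤ n / 4
  ≤n/4 {k} 4k≤n = subst (_≤ n / 4) (m*n/n≡m k 4) (/-monoˡ-≤ 4 (subst (_≤ n) (*-comm 4 k) 4k≤n))

  #quadruples-over-C : ∀ {C} → IsLargeCyclic C → ∀ {Z₀} → IsElementaryComplement C Z₀ →
    ∀ ys → Unique ys → All (λ q → Valid q × proj₁ q ≡ C) ys → length ys ≤ n / 4 * (4 * 2 ^ (n / 4))
  #quadruples-over-C {C} C-cyclic {Z₀} Z₀-compl ys u ys-over = begin
    length ys                          ≤⟨ length≤∣keys∣*fibre _≟ₛ_ complementOf _ _ ys u ys-over fibre ⟩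
    length Zs * (4 * 2 ^ (n / 4))      ≤⟨ *-monoˡ-≤ _ (#complements≤∣Z₀∣ Zs (keys-Unique _≟ₛ_ complementOf ys)
                                                         (All.tabulate complement)) ⟩
    ∣ Z₀ ∣ * (4 * 2 ^ (n / 4))         ≤⟨ *-monoˡ-≤ _ (≤n/4 {∣ Z₀ ∣} (4*∣Z∣≤n Z₀-compl)) ⟩
    n / 4 * (4 * 2 ^ (n / 4))          ∎
    where
      open ≤-Reasoning
      open Complements C-cyclic
      open RelativeTo Z₀-compl

      complementOf : Quad → Subset n
      complementOf q = proj₁ (proj₂ q)

      Zs = keys _≟ₛ_ complementOf ys

      complement : ∀ {Z} → Z ∈ₗ Zs → IsElementaryComplement C Z
      complement p with ∈-keys⁻ _≟ₛ_ complementOf ys p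
      ... | q , q∈ys , refl with All.lookup ys-over q∈ys
      ...   | q-valid , refl = Valid⇒IsElementaryComplement q-valid

      fibre : ∀ {Z} → Z ∈ₗ Zs → ∀ zs → Unique zs →
        All (λ q → (Valid q × proj₁ q ≡ C) × complementOf q ≡ Z) zs → length zs ≤ 4 * 2 ^ (n / 4)
      fibre {Z} p zs u′ zs-over = ≤-trans (#quadruples-over-C,Z zs u′ zs-over)
        (*-monoʳ-≤ 4 (^-monoʳ-≤ 2 (≤n/4 {∣ Z ∣} (4*∣Z∣≤n (complement p)))))

  #quadruples : ∀ qs → Unique qs → All Valid qs →
    ∃ λ c → 2 * c ≤ n × length qs ≤ c * (n / 4 * (4 * 2 ^ (n / 4)))
  #quadruples qs u qs-valid =
    length Cs ,
    2*#largeCyclic≤n Cs (keys-Unique _≟ₛ_ proj₁ qs) (All.tabulate (λ p → proj₁ (representative p))) ,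
    length≤∣keys∣*fibre _≟ₛ_ proj₁ Valid _ qs u qs-valid
      (λ p → let C-cyclic , _ , Z₀-compl = representative p in #quadruples-over-C C-cyclic Z₀-compl)
    where
      Cs = keys _≟ₛ_ proj₁ qs

      representative : ∀ {C} → C ∈ₗ Cs → IsLargeCyclic C × ∃ (IsElementaryComplement C)
      representative p with ∈-keys⁻ _≟ₛ_ proj₁ qs p
      ... | q , q∈qs , refl = let q-valid = All.lookup qs-valid q∈qs in
        Valid⇒IsLargeCyclic q-valid , _ , Valid⇒IsElementaryComplement q-valid

counting⇒bound : ∀ n c L → 2 * c ≤ n → L ≤ c * (n / 4 * (4 * 2 ^ (n / 4))) → (2 * L) ^ 4 ≤ 2 ^ n * n ^ 8
counting⇒bound n c L 2c≤n L≤ = begin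
  (2 * L) ^ 4         ≤⟨ ^-monoˡ-≤ 4 2L≤n²2ᵐ ⟩
  (n * n * 2ᵐ) ^ 4    ≡⟨ solve 2 (λ n p → (n :* n :* p) :^ 4 := (p :^ 4) :* (n :^ 8)) refl n 2ᵐ ⟩
  2ᵐ ^ 4 * n ^ 8      ≤⟨ *-monoˡ-≤ (n ^ 8) (≤-trans (≤-reflexive (^-*-assoc 2 m 4)) (^-monoʳ-≤ 2 (m/n*n≤m n 4))) ⟩
  2 ^ n * n ^ 8       ∎
  where
    open ≤-Reasoning
    open +-*-Solver
    m = n / 4
    2ᵐ = 2 ^ m
    4m≤n : 4 * m ≤ n
    4m≤n = ≤-trans (≤-reflexive (*-comm 4 m)) (m/n*n≤m n 4)
    2L≤n²2ᵐ : 2 * L ≤ n * n * 2ᵐ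
    2L≤n²2ᵐ = begin
      2 * L                    ≤⟨ *-monoʳ-≤ 2 L≤ ⟩
      2 * (c * (m * (4 * 2ᵐ))) ≡⟨ solve 3 (λ c m p → con 2 :* (c :* (m :* (con 4 :* p)))
                                                   := (con 2 :* c) :* (con 4 :* m) :* p) refl c m 2ᵐ ⟩
      (2 * c) * (4 * m) * 2ᵐ   ≤⟨ *-monoˡ-≤ 2ᵐ (*-mono-≤ 2c≤n 4m≤n) ⟩
      n * n * 2ᵐ               ∎

lemma5p3 : (n : ℕ) (_∙_ : Fin n → Fin n → Fin n) (ε : Fin n) (_⁻¹ : Fin n → Fin n) →
           IsAbelianGroup _≡_ _∙_ ε _⁻¹ →
           (qs : List (GroupDefs.Quad _∙_ ε _⁻¹)) → Unique qs →
           All (GroupDefs.Valid _∙_ ε _⁻¹) qs →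
           (2 * length qs) ^ 4 ≤ 2 ^ n * n ^ 8
lemma5p3 n _ _ _ isAbelianGroup qs u qs-valid =
  let c , 2c≤n , L≤ = #quadruples qs u qs-valid in counting⇒bound n c (length qs) 2c≤n L≤
  where open FiniteAbelianGroup isAbelianGroup
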